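{- Let $\Phi$ be a domain with $|\Phi|=n$. There is a $\mathrm{PL}(\{\wedge,{\sim},\mathbin{\dot\vee}\})$-formula $\varphi$ of length $O(n^2)$ such that for every $\Phi$-team $T$: $T\models\varphi$ iff $|T|$ is odd.
   Context: A domain $\Phi$ is a finite set of propositional variables; a $\Phi$-assignment is a map $s:\Phi\to\{0,1\}$; a $\Phi$-team is a (possibly empty) set of $\Phi$-assignments. A strict split of $T$ is a pair $(T_1,T_2)$ with $T_1\cup T_2=T$ and $T_1\cap T_2=\emptyset$. $\mathrm{PL}(\{\wedge,{\sim},\mathbin{\dot\vee}\})$ is the set of formulas built from the literals $\top,\bot,p,\neg p$ ($p\in\Phi$) using $\wedge$, ${\sim}$ (applicable to any formula) and $\mathbin{\dot\vee}$. Semantics: $T\models\top$ always; $T\models\bot$ iff $T=\emptyset$; $T\models p$ iff $s(p)=1$ for all $s\in T$; $T\models\neg p$ iff $s(p)=0$ for all $s\in T$; $T\models{\sim}\psi$ iff $T\not\models\psi$; $\wedge$ is conjunction; $T\models\psi\mathbin{\dot\vee}\theta$ iff there is a strict split $(S,U)$ of $T$ with $S\models\psi$ and $U\models\theta$. Length = length as a string, each variable counting as one symbol. -}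

module Defs where

open import Data.Nat using (ℕ; zero; suc; _+_)
open import Data.Bool using (Bool; true; false; if_then_else_; _∧_; _∨_)
open import Data.Fin using (Fin)
open import Data.Vec using (Vec; []; _∷_; lookup)
open import Data.List using (List; []; _∷_; map; _++_)
open import Data.Nat.ListAction using (sum)
open import Data.Product using (Σ; _×_; _,_)
open import Data.Empty using (⊥)
open import Data.Unit using (⊤)
open import Relation.Nullary using (¬_)
open import Relation.Binary.PropositionalEquality using (_≡_)

-- Domain Φ = Fin n (n propositional variables).
-- A Φ-assignment is a bit-vector of length n.
Assignment : ℕ → Set
Assignment n = Vec Bool n

Team : ℕ → Set
Team n = Assignment n → Bool

-- All Φ-assignments (each exactly once).
allAssignments : (n : ℕ) → List (Assignment n)
allAssignments zero = [] ∷ []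
allAssignments (suc n) =
  map (true ∷_) (allAssignments n) ++ map (false ∷_) (allAssignments n)

card : {n : ℕ} → Team n → ℕ
card {n} T = sum (map (λ s → if T s then 1 else 0) (allAssignments n))

StrictSplit : {n : ℕ} → Team n → Team n → Team n → Set
StrictSplit T T₁ T₂ =
  ∀ s → ((T₁ s ∨ T₂ s) ≡ T s) × ((T₁ s ∧ T₂ s) ≡ false)

data Form (n : ℕ) : Set where
  top bot     : Form n
  var nvar    : Fin n → Form n          -- p and ¬p
  _∧'_        : Form n → Form n → Form n
  ∼_          : Form n → Form n
  _∨̇_         : Form n → Form n → Form n

-- Length as a string: ⊤, ⊥, p have length 1; ¬p length 2;
-- (φ ∧ ψ) and (φ ∨̇ ψ) add 3 symbols (two brackets and the connective);
-- ∼φ adds 1.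
len : {n : ℕ} → Form n → ℕ
len top = 1
len bot = 1
len (var p) = 1
len (nvar p) = 2
len (φ ∧' ψ) = len φ + len ψ + 3
len (∼ φ) = len φ + 1
len (φ ∨̇ ψ) = len φ + len ψ + 3

_⊨_ : {n : ℕ} → Team n → Form n → Set
T ⊨ top = ⊤
T ⊨ bot = ∀ s → T s ≡ false
T ⊨ var p = ∀ s → T s ≡ true → lookup s p ≡ true
T ⊨ nvar p = ∀ s → T s ≡ true → lookup s p ≡ false
T ⊨ (φ ∧' ψ) = (T ⊨ φ) × (T ⊨ ψ)
T ⊨ (∼ φ) = ¬ (T ⊨ φ)
T ⊨ (φ ∨̇ ψ) = Σ (Team _) λ S → Σ (Team _) λ U → StrictSplit T S U × (S ⊨ φ) × (U ⊨ ψ)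

{-# OPTIONS --safe #-}
-- Call a team distinct on a list L of variables if no two of its assignments agree on L. By
-- recursion on L we build parity L, which holds in a team S distinct on L iff |S| is odd. For
-- L = [] such an S has at most one element, so parity [] says that S is non-empty. For b ∷ L,
-- call t a partner of s if it agrees with s on L and differs at b; in S it is unique if it
-- exists. The elements of S with a partner form a paired, hence even, subteam, and the others
-- are distinct on L; so parity (b ∷ L) splits S into a part that is distinct on L and
-- satisfies parity L, and a part in which every element has a partner. Both side conditions
-- are expressible with ∼ and ∨̇ in O(|L|) symbols, so parity L has length O(|L|²), and every
-- team is distinct on the list of all n variables.
module Submission where

open import Defs
open import Data.Bool using (Bool; true; false; not; _∧_; _∨_; if_then_else_)
open import Data.Bool.Properties using (_≟_; ¬-not; not-¬; ∨-comm; ∧-comm; ∧-identityʳ; ∧-zeroʳ)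
open import Data.Empty using (⊥; ⊥-elim)
open import Data.Fin using (Fin)
open import Data.List using (List; []; _∷_; map; _++_; length; allFin)
open import Data.List.Properties using (map-++; map-cong; map-∘; length-tabulate)
open import Data.List.Membership.Propositional.Properties using (∈-allFin)
open import Data.List.Membership.Propositional using () renaming (_∈_ to _∈ₗ_)
open import Data.List.Relation.Unary.Any using (here; there)
open import Data.Nat using (ℕ; suc; _+_; _*_; _≤_; _%_; z≤n; s≤s)
open import Data.Nat.DivMod using (%-distribˡ-+; m%n%n≡m%n)
open import Data.Nat.ListAction using (sum)
open import Data.Nat.ListAction.Properties using (sum-++)
open import Data.Nat.Properties
  using (≤-refl; +-identityʳ; +-monoˡ-≤; m≤m+n; +-commutativeSemigroup; module ≤-Reasoning)
open import Data.Nat.Tactic.RingSolver using (solve-∀)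
open import Algebra.Properties.CommutativeSemigroup +-commutativeSemigroup using (interchange)
open import Data.Product using (Σ; _×_; _,_; proj₁; proj₂; ∃; ∃-syntax)
open import Data.Sum using (_⊎_; inj₁; inj₂)
open import Data.Unit using (tt)
open import Data.Vec using ([]; _∷_; lookup; tabulate)
open import Data.Vec.Properties using (≡-dec; tabulate∘lookup; tabulate-cong)
open import Function using (_∘_; id)
open import Function.Bundles using (_⇔_; mk⇔)
open import Relation.Binary.Definitions using (DecidableEquality)
open import Relation.Binary.PropositionalEquality
  using (_≡_; _≢_; refl; sym; trans; cong; cong₂; subst; module ≡-Reasoning)
open import Relation.Nullary using (¬_; Dec; yes; no; does; _×-dec_; _⊎-dec_; ¬?)
open import Relation.Nullary.Decidable using (map′; dec-true; decidable-stable)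
open import Relation.Unary using (Decidable)
open import Relation.Unary.Properties using (∁?)

private variable
  n : ℕ
  b i : Fin n
  L : List (Fin n)
  s t u : Assignment n
  S T R : Team n

-- Teams and their cardinality

indicator : Bool → ℕ
indicator x = if x then 1 else 0

countIn : {A : Set} → (A → Bool) → List A → ℕ
countIn P xs = sum (map (indicator ∘ P) xs)

countIn-++ : {A : Set} (P : A → Bool) (xs ys : List A) →
             countIn P (xs ++ ys) ≡ countIn P xs + countIn P ys
countIn-++ P xs ys =
  trans (cong sum (map-++ (indicator ∘ P) xs ys)) (sum-++ (map (indicator ∘ P) xs) (map (indicator ∘ P) ys))

countIn-map : {A B : Set} (P : B → Bool) (f : A → B) (xs : List A) →
              countIn P (map f xs) ≡ countIn (P ∘ f) xs
countIn-map P f xs = cong sum (sym (map-∘ xs))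

countIn-≗ : {A : Set} {P Q : A → Bool} → (∀ x → P x ≡ Q x) →
            (xs : List A) → countIn P xs ≡ countIn Q xs
countIn-≗ P≗Q xs = cong sum (map-cong (cong indicator ∘ P≗Q) xs)

countIn-none : {A : Set} {P : A → Bool} → (∀ x → P x ≡ false) →
               (xs : List A) → countIn P xs ≡ 0
countIn-none none [] = refl
countIn-none none (x ∷ xs) rewrite none x = countIn-none none xs

indicator-split : ∀ {x y z} → (x ∨ y) ≡ z → (x ∧ y) ≡ false →
                  indicator z ≡ indicator x + indicator y
indicator-split {true}  {false} refl _ = refl
indicator-split {false} {true}  refl _ = refl
indicator-split {false} {false} refl _ = refl

countIn-split : StrictSplit T S R → (xs : List (Assignment n)) →
                countIn T xs ≡ countIn S xs + countIn R xs
countIn-split split [] = refl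
countIn-split {T = T} {S} {R} split (x ∷ xs) = begin
  indicator (T x) + countIn T xs
    ≡⟨ cong₂ _+_ (indicator-split {S x} {R x} (proj₁ (split x)) (proj₂ (split x)))
                 (countIn-split {S = S} {R = R} split xs) ⟩
  (indicator (S x) + indicator (R x)) + (countIn S xs + countIn R xs)
    ≡⟨ interchange (indicator (S x)) (indicator (R x)) (countIn S xs) (countIn R xs) ⟩
  (indicator (S x) + countIn S xs) + (indicator (R x) + countIn R xs) ∎
  where open ≡-Reasoning

infix 4 _∈_
record _∈_ {n} (s : Assignment n) (T : Team n) : Set where
  constructor member
  field true-at : T s ≡ true
open _∈_

_∈?_ : (s : Assignment n) (T : Team n) → Dec (s ∈ T)
s ∈? T = map′ member true-at (T s ≟ true)

Empty : Team n → Set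
Empty T = ∀ s → T s ≡ false

_≟ᵃ_ : DecidableEquality (Assignment n)
_≟ᵃ_ = ≡-dec _≟_

∃? : ∀ {n} {P : Assignment n → Set} → Decidable P → Dec (∃ P)
∃? {n = 0} P? = map′ ([] ,_) (λ { ([] , p) → p }) (P? [])
∃? {n = suc n} {P = P} P? =
  map′ join split (∃? (P? ∘ (true ∷_)) ⊎-dec ∃? (P? ∘ (false ∷_)))
  where
  join : ∃ (P ∘ (true ∷_)) ⊎ ∃ (P ∘ (false ∷_)) → ∃ P
  join (inj₁ (s , p)) = true ∷ s , p
  join (inj₂ (s , p)) = false ∷ s , p
  split : ∃ P → ∃ (P ∘ (true ∷_)) ⊎ ∃ (P ∘ (false ∷_))
  split (true ∷ s , p) = inj₁ (s , p)
  split (false ∷ s , p) = inj₂ (s , p)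

nonempty? : (T : Team n) → Dec (∃ (_∈ T))
nonempty? T = ∃? (_∈? T)

¬nonempty⇒empty : ¬ ∃ (_∈ T) → Empty T
¬nonempty⇒empty ∄ s = ¬-not (λ p → ∄ (s , member p))

filter : {P : Assignment n → Set} → Decidable P → Team n → Team n
filter P? T s = T s ∧ does (P? s)

∈-filter⁺ : {P : Assignment n → Set} (P? : Decidable P) → s ∈ T → P s → s ∈ filter P? T
∈-filter⁺ {s = s} P? (member p) q = member (cong₂ _∧_ p (dec-true (P? s) q))

∈-filter⁻ : {P : Assignment n → Set} (P? : Decidable P) → s ∈ filter P? T → s ∈ T × P s
∈-filter⁻ {s = s} {T = T} P? (member p) with T s in s∈T | P? s | p
... | true  | yes q | _  = member s∈T , q
... | true  | no _  | ()
... | false | _     | ()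

filter-split : {P : Assignment n → Set} (P? : Decidable P) (T : Team n) →
               StrictSplit T (filter P? T) (filter (∁? P?) T)
filter-split P? T s with T s | does (P? s)
... | true  | true  = refl , refl
... | true  | false = refl , refl
... | false | _     = refl , refl

split-sym : StrictSplit T S R → StrictSplit T R S
split-sym {S = S} {R = R} split s =
  trans (∨-comm (R s) (S s)) (proj₁ (split s)) , trans (∧-comm (R s) (S s)) (proj₂ (split s))

split-⊆ˡ : StrictSplit T S R → s ∈ S → s ∈ T
split-⊆ˡ {R = R} {s = s} split (member p) = member (trans (sym (proj₁ (split s))) (cong (_∨ R s) p))

split-⊆ʳ : StrictSplit T S R → s ∈ R → s ∈ T
split-⊆ʳ {S = S} {R = R} split = split-⊆ˡ (split-sym {S = S} {R = R} split)

split-disjoint : StrictSplit T S R → s ∈ S → s ∈ R → ⊥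
split-disjoint {s = s} split (member p) (member q) = not-¬ (cong₂ _∧_ p q) (proj₂ (split s))

split-∈ : StrictSplit T S R → s ∈ T → s ∈ S ⊎ s ∈ R
split-∈ {S = S} {R} {s = s} split (member p) with S s in s∈S | R s in s∈R | proj₁ (split s)
... | true  | _     | _ = inj₁ (member s∈S)
... | false | true  | _ = inj₂ (member s∈R)
... | false | false | e = ⊥-elim (not-¬ p (sym e))

singleton : Assignment n → Team n
singleton s u = does (u ≟ᵃ s)

infixl 6 _∖_
_∖_ : Team n → Assignment n → Team n
T ∖ s = filter (∁? (_≟ᵃ s)) T

card-≗ : (∀ s → S s ≡ T s) → card S ≡ card T
card-≗ S≗T = countIn-≗ S≗T (allAssignments _)

card-empty : Empty T → card T ≡ 0
card-empty empty = countIn-none empty (allAssignments _)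

card-split : StrictSplit T S R → card T ≡ card S + card R
card-split split = countIn-split split (allAssignments _)

card-∷ : (T : Team (suc n)) → card T ≡ card (T ∘ (true ∷_)) + card (T ∘ (false ∷_))
card-∷ {n} T = trans (countIn-++ T (map (true ∷_) all) (map (false ∷_) all))
                     (cong₂ _+_ (countIn-map T (true ∷_) all) (countIn-map T (false ∷_) all))
  where all = allAssignments n

card-singleton : (s : Assignment n) → card (singleton s) ≡ 1
card-singleton []          = refl
card-singleton (true ∷ s)  =
  trans (card-∷ (singleton (true ∷ s)))
        (cong₂ _+_ (card-singleton s) (card-empty {T = singleton (true ∷ s) ∘ (false ∷_)} (λ _ → refl)))
card-singleton (false ∷ s) =
  trans (card-∷ (singleton (false ∷ s)))
        (cong₂ _+_ (card-empty {T = singleton (false ∷ s) ∘ (true ∷_)} (λ _ → refl)) (card-singleton s))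

card-remove : s ∈ T → card T ≡ suc (card (T ∖ s))
card-remove {s = s} {T = T} (member p) = begin
  card T                                 ≡⟨ card-split (filter-split (_≟ᵃ s) T) ⟩
  card (filter (_≟ᵃ s) T) + card (T ∖ s) ≡⟨ cong (_+ card (T ∖ s)) (card-≗ at-s) ⟩
  card (singleton s) + card (T ∖ s)      ≡⟨ cong (_+ card (T ∖ s)) (card-singleton s) ⟩
  suc (card (T ∖ s))                     ∎
  where
  open ≡-Reasoning
  at-s : ∀ u → filter (_≟ᵃ s) T u ≡ singleton s u
  at-s u with u ≟ᵃ s
  ... | yes refl = trans (∧-identityʳ _) p
  ... | no _     = ∧-zeroʳ _

+-even-%2 : ∀ m {k} → k % 2 ≡ 0 → (m + k) % 2 ≡ m % 2
+-even-%2 m {k} k-even = begin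
  (m + k) % 2         ≡⟨ %-distribˡ-+ m k 2 ⟩
  (m % 2 + k % 2) % 2 ≡⟨ cong (λ r → (m % 2 + r) % 2) k-even ⟩
  (m % 2 + 0) % 2     ≡⟨ cong (_% 2) (+-identityʳ (m % 2)) ⟩
  m % 2 % 2           ≡⟨ m%n%n≡m%n m 2 ⟩
  m % 2               ∎
  where open ≡-Reasoning

-- Agreement and partners

data Agree {n} : List (Fin n) → Assignment n → Assignment n → Set where
  []  : Agree [] s t
  _∷_ : lookup s i ≡ lookup t i → Agree L s t → Agree (i ∷ L) s t

agree-head : Agree (i ∷ L) s t → lookup s i ≡ lookup t i
agree-head (e ∷ _) = e

agree-tail : Agree (i ∷ L) s t → Agree L s t
agree-tail (_ ∷ a) = a

agree-refl : Agree L s s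
agree-refl {L = []}    = []
agree-refl {L = _ ∷ _} = refl ∷ agree-refl

agree-sym : Agree L s t → Agree L t s
agree-sym []      = []
agree-sym (e ∷ a) = sym e ∷ agree-sym a

agree-trans : Agree L s t → Agree L t u → Agree L s u
agree-trans []      []        = []
agree-trans (e ∷ a) (e′ ∷ a′) = trans e e′ ∷ agree-trans a a′

agree? : (L : List (Fin n)) (s : Assignment n) → Decidable (Agree L s)
agree? []      s t = yes []
agree? (i ∷ L) s t = map′ (λ (e , a) → e ∷ a) (λ a → agree-head a , agree-tail a)
                          ((lookup s i ≟ lookup t i) ×-dec agree? L s t)

agree-lookup : Agree L s t → i ∈ₗ L → lookup s i ≡ lookup t i
agree-lookup (e ∷ _) (here refl) = e
agree-lookup (_ ∷ a) (there i∈L) = agree-lookup a i∈L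

agree-allFin⇒≡ : Agree (allFin n) s t → s ≡ t
agree-allFin⇒≡ {s = s} {t} agree = begin
  s                   ≡⟨ tabulate∘lookup s ⟨
  tabulate (lookup s) ≡⟨ tabulate-cong (λ i → agree-lookup agree (∈-allFin i)) ⟩
  tabulate (lookup t) ≡⟨ tabulate∘lookup t ⟩
  t                   ∎
  where open ≡-Reasoning

Distinct : List (Fin n) → Team n → Set
Distinct L T = ∀ {s t} → s ∈ T → t ∈ T → Agree L s t → s ≡ t

Uniform : List (Fin n) → Team n → Set
Uniform L T = ∀ {s t} → s ∈ T → t ∈ T → Agree L s t

distinct-allFin : Distinct (allFin n) T
distinct-allFin _ _ = agree-allFin⇒≡

distinct-⊆ : (∀ {s} → s ∈ S → s ∈ T) → Distinct L T → Distinct L S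
distinct-⊆ S⊆T distinct s∈S t∈S = distinct (S⊆T s∈S) (S⊆T t∈S)

Partner : Fin n → List (Fin n) → Assignment n → Assignment n → Set
Partner b L s t = Agree L s t × lookup t b ≢ lookup s b

partner-sym : Partner b L s t → Partner b L t s
partner-sym (agree , differ) = agree-sym agree , differ ∘ sym

≢-≢⇒≡ : {x y z : Bool} → x ≢ z → y ≢ z → x ≡ y
≢-≢⇒≡ x≢z y≢z = trans (¬-not x≢z) (sym (¬-not y≢z))

partner-unique : Distinct (b ∷ L) T → t ∈ T → u ∈ T → Partner b L s t → Partner b L s u → t ≡ u
partner-unique distinct t∈T u∈T (agree-t , differ-t) (agree-u , differ-u) =
  distinct t∈T u∈T (≢-≢⇒≡ differ-t differ-u ∷ agree-trans (agree-sym agree-t) agree-u)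

distinct-∷⇒partner : Distinct (b ∷ L) T → s ∈ T → t ∈ T → Agree L s t → s ≢ t → Partner b L s t
distinct-∷⇒partner distinct s∈T t∈T agree s≢t =
  agree , λ same → s≢t (distinct s∈T t∈T (sym same ∷ agree))

HasPartner : Fin n → List (Fin n) → Team n → Assignment n → Set
HasPartner b L T s = ∃ λ t → t ∈ T × Partner b L s t

hasPartner? : (b : Fin n) (L : List (Fin n)) (T : Team n) → Decidable (HasPartner b L T)
hasPartner? b L T s = ∃? (λ t → (t ∈? T) ×-dec (agree? L s t ×-dec ¬? (lookup t b ≟ lookup s b)))

Paired : Fin n → List (Fin n) → Team n → Set
Paired b L T = ∀ {s} → s ∈ T → HasPartner b L T s

paired-remove : Distinct (b ∷ L) T → Paired b L T → s ∈ T →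
                ∃ λ T′ → card T ≡ 2 + card T′ × (∀ {u} → u ∈ T′ → u ∈ T) × Paired b L T′
paired-remove {b = b} {L} {T} {s} distinct paired s∈T with paired s∈T
... | t , t∈T , partner-t = T ∖ s ∖ t , count , ⊆T , paired′
  where
  t∈T∖s : t ∈ T ∖ s
  t∈T∖s = ∈-filter⁺ (∁? (_≟ᵃ s)) t∈T (λ t≡s → proj₂ partner-t (cong (λ x → lookup x b) t≡s))

  count : card T ≡ 2 + card (T ∖ s ∖ t)
  count = trans (card-remove s∈T) (cong suc (card-remove t∈T∖s))

  ⊆T∖s : ∀ {u} → u ∈ T ∖ s ∖ t → u ∈ T ∖ s × u ≢ t
  ⊆T∖s = ∈-filter⁻ (∁? (_≟ᵃ t))

  ⊆T : ∀ {u} → u ∈ T ∖ s ∖ t → u ∈ T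
  ⊆T u∈ = proj₁ (∈-filter⁻ (∁? (_≟ᵃ s)) (proj₁ (⊆T∖s u∈)))

  paired′ : Paired b L (T ∖ s ∖ t)
  paired′ {u} u∈ with paired (⊆T u∈)
  ... | v , v∈T , partner-v =
    v , ∈-filter⁺ (∁? (_≟ᵃ t)) (∈-filter⁺ (∁? (_≟ᵃ s)) v∈T v≢s) v≢t , partner-v
    where
    u≢s : u ≢ s
    u≢s = proj₂ (∈-filter⁻ (∁? (_≟ᵃ s)) (proj₁ (⊆T∖s u∈)))
    u≢t : u ≢ t
    u≢t = proj₂ (⊆T∖s u∈)
    v≢s : v ≢ s
    v≢s refl = u≢t (partner-unique distinct (⊆T u∈) t∈T (partner-sym partner-v) partner-t)
    v≢t : v ≢ t
    v≢t refl = u≢s (partner-unique distinct (⊆T u∈) s∈T (partner-sym partner-v) (partner-sym partner-t))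

card-paired-even : Distinct (b ∷ L) T → Paired b L T → card T % 2 ≡ 0
card-paired-even {b = b} {L} = bounded _ ≤-refl
  where
  bounded : ∀ m {T} → card T ≤ m → Distinct (b ∷ L) T → Paired b L T → card T % 2 ≡ 0
  bounded m {T} card≤m distinct paired with nonempty? T
  ... | no ∄ = cong (_% 2) (card-empty (¬nonempty⇒empty ∄))
  ... | yes (s , s∈T) with paired-remove distinct paired s∈T
  ...   | T′ , count , T′⊆T , paired′ rewrite count = smaller m card≤m
    where
    -- (2 + k) % 2 reduces to k % 2.
    smaller : ∀ m → 2 + card T′ ≤ m → card T′ % 2 ≡ 0
    smaller (suc (suc m)) (s≤s (s≤s card≤m)) = bounded m card≤m (distinct-⊆ T′⊆T distinct) paired′

-- Formulas

nonEmpty : Form n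
nonEmpty = ∼ bot

⊨nonEmpty⁺ : s ∈ T → T ⊨ nonEmpty
⊨nonEmpty⁺ (member p) empty = not-¬ p (empty _)

⊨nonEmpty⁻ : T ⊨ nonEmpty → ∃ (_∈ T)
⊨nonEmpty⁻ {T = T} ¬empty with nonempty? T
... | yes found = found
... | no ∄      = ⊥-elim (¬empty (¬nonempty⇒empty ∄))

lit : Bool → Fin n → Form n
lit true  = var
lit false = nvar

⊨lit⁺ : ∀ v → (∀ {s} → s ∈ T → lookup s i ≡ v) → T ⊨ lit v i
⊨lit⁺ true  h s p = h (member p)
⊨lit⁺ false h s p = h (member p)

⊨lit⁻ : ∀ v → T ⊨ lit v i → s ∈ T → lookup s i ≡ v
⊨lit⁻ true  h (member p) = h _ p
⊨lit⁻ false h (member p) = h _ p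

∈⇒¬⊨lit-not : ∀ {v} → s ∈ T → lookup s i ≡ v → ¬ T ⊨ lit (not v) i
∈⇒¬⊨lit-not {v = v} s∈T s-i h = not-¬ s-i (⊨lit⁻ (not v) h s∈T)

constant : Fin n → Form n
constant i = ∼ ((∼ var i) ∧' (∼ nvar i))

⊨constant⁻ : T ⊨ constant i → s ∈ T → t ∈ T → lookup s i ≡ lookup t i
⊨constant⁻ {i = i} {s = s} {t} h s∈T t∈T with lookup s i in s-i | lookup t i in t-i
... | true  | true  = refl
... | false | false = refl
... | true  | false = ⊥-elim (h (∈⇒¬⊨lit-not t∈T t-i , ∈⇒¬⊨lit-not s∈T s-i))
... | false | true  = ⊥-elim (h (∈⇒¬⊨lit-not s∈T s-i , ∈⇒¬⊨lit-not t∈T t-i))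

⊨constant⁺ : (∀ {s t} → s ∈ T → t ∈ T → lookup s i ≡ lookup t i) → T ⊨ constant i
⊨constant⁺ {T = T} {i = i} const (¬all-true , ¬all-false) with nonempty? T
... | no ∄ = ¬all-true (⊨lit⁺ true (λ s∈T → ⊥-elim (∄ (_ , s∈T))))
... | yes (e , e∈T) with lookup e i in e-i
...   | true  = ¬all-true  (⊨lit⁺ true  (λ s∈T → trans (const s∈T e∈T) e-i))
...   | false = ¬all-false (⊨lit⁺ false (λ s∈T → trans (const s∈T e∈T) e-i))

constantOn : List (Fin n) → Form n
constantOn []      = top
constantOn (i ∷ L) = constant i ∧' constantOn L

⊨constantOn⁻ : ∀ L → T ⊨ constantOn L → Uniform L T
⊨constantOn⁻ []      _        _   _   = []
⊨constantOn⁻ (i ∷ L) (c , cs) s∈T t∈T = ⊨constant⁻ c s∈T t∈T ∷ ⊨constantOn⁻ L cs s∈T t∈T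

⊨constantOn⁺ : ∀ L → Uniform L T → T ⊨ constantOn L
⊨constantOn⁺ []      _       = tt
⊨constantOn⁺ (i ∷ L) uniform =
  ⊨constant⁺ (λ s∈T t∈T → agree-head (uniform s∈T t∈T)) ,
  ⊨constantOn⁺ L (λ s∈T t∈T → agree-tail (uniform s∈T t∈T))

atLeastTwo : Form n
atLeastTwo = nonEmpty ∨̇ nonEmpty

⊨atLeastTwo⁻ : T ⊨ atLeastTwo → ∃[ s ] ∃[ t ] s ∈ T × t ∈ T × s ≢ t
⊨atLeastTwo⁻ (S , R , split , S≠∅ , R≠∅) with ⊨nonEmpty⁻ S≠∅ | ⊨nonEmpty⁻ R≠∅
... | s , s∈S | t , t∈R =
  s , t , split-⊆ˡ split s∈S , split-⊆ʳ {S = S} split t∈R ,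
  λ { refl → split-disjoint split s∈S t∈R }

⊨atLeastTwo⁺ : s ∈ T → t ∈ T → s ≢ t → T ⊨ atLeastTwo
⊨atLeastTwo⁺ {s = s} {T = T} s∈T t∈T s≢t =
  filter (_≟ᵃ s) T , T ∖ s , filter-split (_≟ᵃ s) T ,
  ⊨nonEmpty⁺ (∈-filter⁺ (_≟ᵃ s) s∈T refl) , ⊨nonEmpty⁺ (∈-filter⁺ (∁? (_≟ᵃ s)) t∈T (s≢t ∘ sym))

distinctOn : List (Fin n) → Form n
distinctOn L = ∼ ((atLeastTwo ∧' constantOn L) ∨̇ top)

⊨distinctOn⁺ : ∀ L → Distinct L T → T ⊨ distinctOn L
⊨distinctOn⁺ L distinct (Z , _ , split , (two , uniform) , _) with ⊨atLeastTwo⁻ two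
... | s , t , s∈Z , t∈Z , s≢t =
  s≢t (distinct (split-⊆ˡ split s∈Z) (split-⊆ˡ split t∈Z) (⊨constantOn⁻ L uniform s∈Z t∈Z))

-- The witness is the class of s modulo agreement on L, which contains t.
⊨distinctOn⁻ : ∀ L → T ⊨ distinctOn L → Distinct L T
⊨distinctOn⁻ {T = T} L h {s} {t} s∈T t∈T agree with s ≟ᵃ t
... | yes s≡t = s≡t
... | no s≢t  = ⊥-elim (h (class , _ , filter-split (agree? L s) T , (two , ⊨constantOn⁺ L uniform) , tt))
  where
  class : Team _
  class = filter (agree? L s) T
  two : class ⊨ atLeastTwo
  two = ⊨atLeastTwo⁺ (∈-filter⁺ (agree? L s) s∈T agree-refl) (∈-filter⁺ (agree? L s) t∈T agree) s≢t
  uniform : Uniform L class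
  uniform u∈ w∈ = agree-trans (agree-sym (proj₂ (∈-filter⁻ (agree? L s) u∈)))
                              (proj₂ (∈-filter⁻ (agree? L s) w∈))

-- For R distinct on b ∷ L: some s ∈ R with s(b) = v lies in a part distinct on L whose
-- complement has value v at b, so no partner of s can exist in R.
unpaired : Bool → Fin n → List (Fin n) → Form n
unpaired v b L = (distinctOn L ∧' ((lit v b ∧' nonEmpty) ∨̇ top)) ∨̇ lit v b

paired⇒¬⊨unpaired : ∀ v → Paired b L R → ¬ R ⊨ unpaired v b L
paired⇒¬⊨unpaired {b = b} {L} v paired
  (V , A , split , (distinctV , (W , _ , splitW , (W-v , W≠∅) , _)) , A-v)
  with ⊨nonEmpty⁻ W≠∅
... | s , s∈W with split-⊆ˡ splitW s∈W
... | s∈V with paired (split-⊆ˡ split s∈V)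
... | t , t∈R , agree , differ with split-∈ split t∈R
...   | inj₁ t∈V = differ (cong (λ x → lookup x b) (sym (⊨distinctOn⁻ L distinctV s∈V t∈V agree)))
...   | inj₂ t∈A = differ (trans (⊨lit⁻ v A-v t∈A) (sym (⊨lit⁻ v W-v s∈W)))

-- As s has no partner, s together with the elements differing from s at b is distinct on L.
⊨unpaired⁺ : Distinct (b ∷ L) R → s ∈ R → ¬ HasPartner b L R s → R ⊨ unpaired (lookup s b) b L
⊨unpaired⁺ {b = b} {L} {R} {s} distinct s∈R lonely =
  V , A , filter-split inV? R , (⊨distinctOn⁺ L distinctV , s-witness) , ⊨lit⁺ v A-v
  where
  v : Bool
  v = lookup s b
  inV? : Decidable (λ u → u ≡ s ⊎ lookup u b ≢ v)
  inV? u = (u ≟ᵃ s) ⊎-dec ¬? (lookup u b ≟ v)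
  V A : Team _
  V = filter inV? R
  A = filter (∁? inV?) R

  A-v : ∀ {u} → u ∈ A → lookup u b ≡ v
  A-v {u} u∈A = decidable-stable (lookup u b ≟ v) (proj₂ (∈-filter⁻ (∁? inV?) u∈A) ∘ inj₂)

  distinctV : Distinct L V
  distinctV u∈V w∈V agree with ∈-filter⁻ inV? u∈V | ∈-filter⁻ inV? w∈V
  ... | _   , inj₁ refl | _   , inj₁ refl = refl
  ... | _   , inj₁ refl | w∈R , inj₂ w≢v  = ⊥-elim (lonely (_ , w∈R , agree , w≢v))
  ... | u∈R , inj₂ u≢v  | _   , inj₁ refl = ⊥-elim (lonely (_ , u∈R , agree-sym agree , u≢v))
  ... | u∈R , inj₂ u≢v  | w∈R , inj₂ w≢v  = distinct u∈R w∈R (≢-≢⇒≡ u≢v w≢v ∷ agree)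

  s-witness : V ⊨ ((lit v b ∧' nonEmpty) ∨̇ top)
  s-witness =
    filter (_≟ᵃ s) V , V ∖ s , filter-split (_≟ᵃ s) V ,
    (⊨lit⁺ v (λ u∈ → cong (λ x → lookup x b) (proj₂ (∈-filter⁻ (_≟ᵃ s) u∈))) ,
     ⊨nonEmpty⁺ (∈-filter⁺ (_≟ᵃ s) (∈-filter⁺ inV? s∈R (inj₁ refl)) refl)) ,
    tt

allPaired : Fin n → List (Fin n) → Form n
allPaired b L = (∼ unpaired true b L) ∧' (∼ unpaired false b L)

⊨allPaired⁺ : Paired b L R → R ⊨ allPaired b L
⊨allPaired⁺ paired = paired⇒¬⊨unpaired true paired , paired⇒¬⊨unpaired false paired

⊨allPaired⁻ : Distinct (b ∷ L) R → R ⊨ allPaired b L → Paired b L R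
⊨allPaired⁻ {b = b} {L} {R} distinct h {s} s∈R with hasPartner? b L R s
... | yes found = found
... | no lonely = ⊥-elim (¬⊨unpaired (lookup s b) (⊨unpaired⁺ distinct s∈R lonely))
  where
  ¬⊨unpaired : ∀ v → ¬ R ⊨ unpaired v b L
  ¬⊨unpaired true  = proj₁ h
  ¬⊨unpaired false = proj₂ h

parity : List (Fin n) → Form n
parity []      = nonEmpty
parity (b ∷ L) = (distinctOn L ∧' parity L) ∨̇ allPaired b L

⊨parity⁻ : ∀ L → Distinct L S → S ⊨ parity L → card S % 2 ≡ 1
⊨parity⁻ {S = S} [] distinct S≠∅ with ⊨nonEmpty⁻ S≠∅
... | s , s∈S = cong (_% 2) (trans (card-remove s∈S) (cong suc (card-empty (¬nonempty⇒empty only-s))))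
  where
  only-s : ¬ ∃ (_∈ S ∖ s)
  only-s (u , u∈) = let u∈S , u≢s = ∈-filter⁻ (∁? (_≟ᵃ s)) u∈ in u≢s (distinct u∈S s∈S [])
⊨parity⁻ {S = S} (b ∷ L) distinct (Y , Z , split , (distinctY , parityY) , allPairedZ) = begin
  card S % 2             ≡⟨ cong (_% 2) (card-split split) ⟩
  (card Y + card Z) % 2  ≡⟨ +-even-%2 (card Y) (card-paired-even distinctZ pairedZ) ⟩
  card Y % 2             ≡⟨ ⊨parity⁻ L (⊨distinctOn⁻ L distinctY) parityY ⟩
  1                      ∎
  where
  open ≡-Reasoning
  distinctZ : Distinct (b ∷ L) Z
  distinctZ = distinct-⊆ (split-⊆ʳ {S = Y} split) distinct
  pairedZ : Paired b L Z
  pairedZ = ⊨allPaired⁻ distinctZ allPairedZ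

⊨parity⁺ : ∀ L → Distinct L S → card S % 2 ≡ 1 → S ⊨ parity L
⊨parity⁺ {S = S} [] _ odd empty with trans (sym odd) (cong (_% 2) (card-empty empty))
... | ()
⊨parity⁺ {S = S} (b ∷ L) distinct odd =
  Y , Z , split , (⊨distinctOn⁺ L distinctY , ⊨parity⁺ L distinctY oddY) , ⊨allPaired⁺ pairedZ
  where
  Y Z : Team _
  Z = filter (hasPartner? b L S) S
  Y = filter (∁? (hasPartner? b L S)) S
  split : StrictSplit S Y Z
  split = split-sym {S = Z} {R = Y} (filter-split (hasPartner? b L S) S)

  distinctY : Distinct L Y
  distinctY {u} {w} u∈Y w∈Y agree with u ≟ᵃ w
  ... | yes u≡w = u≡w
  ... | no u≢w  =
    let u∈S , lonely = ∈-filter⁻ (∁? (hasPartner? b L S)) u∈Y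
        w∈S , _      = ∈-filter⁻ (∁? (hasPartner? b L S)) w∈Y
    in ⊥-elim (lonely (w , w∈S , distinct-∷⇒partner distinct u∈S w∈S agree u≢w))

  pairedZ : Paired b L Z
  pairedZ {u} u∈Z with ∈-filter⁻ (hasPartner? b L S) u∈Z
  ... | u∈S , (w , w∈S , partner) =
    w , ∈-filter⁺ (hasPartner? b L S) w∈S (u , u∈S , partner-sym partner) , partner

  distinctZ : Distinct (b ∷ L) Z
  distinctZ = distinct-⊆ (split-⊆ʳ {S = Y} split) distinct

  oddY : card Y % 2 ≡ 1
  oddY = begin
    card Y % 2            ≡⟨ +-even-%2 (card Y) (card-paired-even distinctZ pairedZ) ⟨
    (card Y + card Z) % 2 ≡⟨ cong (_% 2) (card-split split) ⟨
    card S % 2            ≡⟨ odd ⟩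
    1                     ∎
    where open ≡-Reasoning

-- Length of the parity formula

len-constantOn : (L : List (Fin n)) → len (constantOn L) ≡ 12 * length L + 1
len-constantOn []      = refl
len-constantOn (i ∷ L) = trans (cong (λ c → 9 + c + 3) (len-constantOn L)) (arith (length L))
  where
  arith : ∀ m → 9 + (12 * m + 1) + 3 ≡ 12 * suc m + 1
  arith = solve-∀

len-distinctOn : (L : List (Fin n)) → len (distinctOn L) ≡ 12 * length L + 16
len-distinctOn L = trans (cong (λ c → 7 + c + 3 + 1 + 3 + 1) (len-constantOn L)) (arith (length L))
  where
  arith : ∀ m → 7 + (12 * m + 1) + 3 + 1 + 3 + 1 ≡ 12 * m + 16
  arith = solve-∀

len-allPaired : (b : Fin n) (L : List (Fin n)) → len (allPaired b L) ≡ 24 * length L + 73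
len-allPaired b L =
  trans (cong (λ d → (d + 10 + 3 + 1 + 3 + 1) + (d + 11 + 3 + 2 + 3 + 1) + 3) (len-distinctOn L))
        (arith (length L))
  where
  arith : ∀ m → (12 * m + 16 + 10 + 3 + 1 + 3 + 1) + (12 * m + 16 + 11 + 3 + 2 + 3 + 1) + 3 ≡ 24 * m + 73
  arith = solve-∀

len-parity-∷ : (b : Fin n) (L : List (Fin n)) →
               len (parity (b ∷ L)) ≡ len (parity L) + (36 * length L + 95)
len-parity-∷ b L =
  trans (cong₂ (λ d a → d + len (parity L) + 3 + a + 3) (len-distinctOn L) (len-allPaired b L))
        (arith (length L) (len (parity L)))
  where
  arith : ∀ m p → 12 * m + 16 + p + 3 + (24 * m + 73) + 3 ≡ p + (36 * m + 95)
  arith = solve-∀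

len-parity : (L : List (Fin n)) → len (parity L) ≤ 100 * (length L * length L + 1)
len-parity []      = s≤s (s≤s z≤n)
len-parity (b ∷ L) = begin
  len (parity (b ∷ L))                                   ≡⟨ len-parity-∷ b L ⟩
  len (parity L) + (36 * m + 95)                         ≤⟨ +-monoˡ-≤ (36 * m + 95) (len-parity L) ⟩
  100 * (m * m + 1) + (36 * m + 95)                      ≤⟨ m≤m+n _ (164 * m + 5) ⟩
  100 * (m * m + 1) + (36 * m + 95) + (164 * m + 5)      ≡⟨ arith m ⟩
  100 * (suc m * suc m + 1)                              ∎
  where
  open ≤-Reasoning
  m : ℕ
  m = length L
  arith : ∀ m → 100 * (m * m + 1) + (36 * m + 95) + (164 * m + 5) ≡ 100 * (suc m * suc m + 1)
  arith = solve-∀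

len-parity-allFin : (n : ℕ) → len (parity (allFin n)) ≤ 100 * (n * n + 1)
len-parity-allFin n = subst (λ m → len (parity (allFin n)) ≤ 100 * (m * m + 1))
                            (length-tabulate {n = n} id) (len-parity (allFin n))

theorem4p10 : ∃[ C ] ∀ (n : ℕ) → Σ (Form n) λ φ →
                (len φ ≤ C * (n * n + 1)) ×
                (∀ (T : Team n) → (T ⊨ φ) ⇔ (card T % 2 ≡ 1))
theorem4p10 = 100 , λ n → parity (allFin n) , len-parity-allFin n ,
  λ T → mk⇔ (⊨parity⁻ (allFin n) distinct-allFin) (⊨parity⁺ (allFin n) distinct-allFin)
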